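{- Let $r\ge 1$ and $k\ge 1$ be integers. For any initial state $\vec a$ and final state $\vec b$ in $\mathcal H_{r,k}$, the Hanoi game on $\mathcal H_{r,k}$ can be solved (i.e. $\vec a$ transformed into $\vec b$) in at most $2^k-1$ moves. The same holds for the Hanoi game on $\mathcal H^*_{r,k}$ for any $\vec a,\vec b\in\mathcal H^*_{r,k}$.
   Context: A Hanoi state is a finite sequence of nonnegative integers $\vec x=(x_1,\dots,x_k)$ with $x_i\ne x_{i-1}$ for all $i>1$. Let $\mathcal H_{r,k}$ be the set of Hanoi states in $\{0,1,\dots,r\}^k$, and let $\mathcal H^*_{r,k}\subset \mathcal H_{r,k}$ be the set of proper Hanoi states, i.e. those with $x_1\ne 0$. In the Hanoi game on $\mathcal H_{r,k}$, a state is transformed by moves of two types: (1) an adjustment of $\vec x$ changes $x_k$ to any other value in $\{0,1,\dots,r\}$ different from $x_{k-1}$ (when $k=1$, to any other value); (2) an involution of $\vec x$ (for $k\ge 2$) finds the longest tail segment $(x_j,\dots,x_k)$ of $\vec x$ on which the entries alternate between the values $x_k$ and $x_{k-1}$, and swaps the values $x_k$ and $x_{k-1}$ throughout that segment (e.g. $(1,2,3,4)\mapsto(1,2,4,3)$, $(1,2,1,2)\mapsto(2,1,2,1)$). The Hanoi game on $\mathcal H^*_{r,k}$ is the same, but with the requirement that all states involved (including intermediate ones) be proper Hanoi states. -}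

module Defs where

open import Data.Nat using (ℕ; zero; suc; _≤_; _≟_)
open import Data.List using (List; []; _∷_; _++_; [_]; length; reverse; last)
open import Data.List.Relation.Unary.All using (All)
open import Data.Maybe using (Maybe; just; nothing)
open import Data.Product using (_×_)
open import Data.Sum using (_⊎_)
open import Data.Bool using (if_then_else_)
open import Relation.Nullary using (¬_)
open import Relation.Nullary.Decidable using (⌊_⌋)
open import Relation.Binary.PropositionalEquality using (_≡_; _≢_)

-- States are lists (x₁, …, x_k) of natural numbers (x₁ is the head).

data AdjDistinct : List ℕ → Set where
  nil  : AdjDistinct []
  one  : ∀ x → AdjDistinct (x ∷ [])
  cons : ∀ {x y xs} → x ≢ y → AdjDistinct (y ∷ xs) → AdjDistinct (x ∷ y ∷ xs)

record HanoiState (r k : ℕ) (xs : List ℕ) : Set where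
  field
    len      : length xs ≡ k
    inRange  : All (_≤ r) xs
    distinct : AdjDistinct xs

data FirstNonzero : List ℕ → Set where
  fnz : ∀ {x xs} → x ≢ 0 → FirstNonzero (x ∷ xs)

ProperHanoiState : (r k : ℕ) → List ℕ → Set
ProperHanoiState r k xs = HanoiState r k xs × FirstNonzero xs

data Adjustment (r : ℕ) : List ℕ → List ℕ → Set where
  adjust : ∀ (pre : List ℕ) (x y : ℕ) → y ≤ r → y ≢ x →
           (∀ z → last pre ≡ just z → y ≢ z) →
           Adjustment r (pre ++ [ x ]) (pre ++ [ y ])

-- On the REVERSED state (x_k, x_{k-1}, …): swap the values along the maximal
-- prefix that reads a, b, a, b, … (a = x_k, b = x_{k-1}).
swapAlt : ℕ → ℕ → List ℕ → List ℕ
swapAlt a b []       = []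
swapAlt a b (x ∷ xs) = if ⌊ x ≟ a ⌋ then b ∷ swapAlt b a xs else x ∷ xs

data Involution : List ℕ → List ℕ → Set where
  involute : ∀ (a b : ℕ) (rest : List ℕ) →
             Involution (reverse (a ∷ b ∷ rest)) (reverse (swapAlt a b (a ∷ b ∷ rest)))

Move : ℕ → List ℕ → List ℕ → Set
Move r xs ys = Adjustment r xs ys ⊎ Involution xs ys

data Reach (r : ℕ) (Good : List ℕ → Set) : ℕ → List ℕ → List ℕ → Set where
  done : ∀ {xs} → Good xs → Reach r Good 0 xs xs
  step : ∀ {n xs ys zs} → Good xs → Move r xs ys → Reach r Good n ys zs →
         Reach r Good (suc n) xs zs

module Submission where

-- We solve the more general problem of moving p ++ s to p ++ t, where the
-- prefix p is frozen and only the suffix (of length m) changes, within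
-- 2^m − 1 moves, by induction on m.
--   * If s and t start with the same value x, freeze x as well and recurse.
--   * If s = x ∷ s' and t = y ∷ t' with x ≠ y and m = 1, one adjustment works.
--   * Otherwise move s' to the alternating tail y,x,y,… (recursion), perform
--     one involution, which turns the alternating tail x,y,x,… behind p into
--     y,x,y,… (the segment stops at p because the last entry of p differs
--     from x and y), and move the tail x,y,… to t' (recursion):
--     (2^(m−1) − 1) + 1 + (2^(m−1) − 1) = 2^m − 1 moves.

open import Defs
open import Data.Nat using (ℕ; zero; suc; _≤_; _<_; _∸_; _^_; _+_; _≟_; z≤n; s≤s)
open import Data.Nat.Properties
  using (+-identityʳ; ≤-trans; <-≤-trans; +-mono-≤; ≤-reflexive; m≤m+n; suc-injective; ∸-monoˡ-≤)
open import Data.List using (List; []; _∷_; _++_; [_]; length; reverse; reverseAcc; last; head)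
open import Data.List.Properties using (++-assoc; reverse-++; reverse-involutive; length-++)
open import Data.List.Relation.Unary.All using (All; []; _∷_)
open import Data.List.Relation.Unary.All.Properties using (++⁺; ++⁻ˡ; ++⁻ʳ)
open import Data.Maybe using (Maybe; just)
open import Data.Product using (_×_; ∃-syntax; _,_; proj₁; swap)
open import Data.Sum using (inj₁; inj₂)
open import Data.Empty using (⊥-elim)
open import Function using (id)
open import Relation.Nullary using (yes; no)
open import Relation.Binary.PropositionalEquality
  using (_≡_; _≢_; refl; sym; trans; cong; subst; subst₂; ≢-sym; module ≡-Reasoning)

head-reverse : (xs : List ℕ) → head (reverse xs) ≡ last xs
head-reverse []       = refl
head-reverse (x ∷ xs) = head-reverseAcc x [] xs
  where
  head-reverseAcc : ∀ y ys xs → head (reverseAcc (y ∷ ys) xs) ≡ last (y ∷ xs)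
  head-reverseAcc y ys []       = refl
  head-reverseAcc y ys (x ∷ xs) = head-reverseAcc x (y ∷ ys) xs

Avoids : ℕ → ℕ → Maybe ℕ → Set
Avoids u v m = ∀ {z} → m ≡ just z → (z ≢ u) × (z ≢ v)

avoids-sym : ∀ {u v m} → Avoids u v m → Avoids v u m
avoids-sym avoid eq = swap (avoid eq)

alt : ℕ → ℕ → ℕ → List ℕ
alt u v zero    = []
alt u v (suc n) = u ∷ alt v u n

-- the last entry of alt u v (suc n)
altEnd : ℕ → ℕ → ℕ → ℕ
altEnd u v zero    = u
altEnd u v (suc n) = altEnd v u n

length-alt : ∀ n u v → length (alt u v n) ≡ n
length-alt zero    u v = refl
length-alt (suc n) u v = cong suc (length-alt n v u)

alt-≤ : ∀ {r} n {u v} → u ≤ r → v ≤ r → All (_≤ r) (alt u v n)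
alt-≤ zero    u≤r v≤r = []
alt-≤ (suc n) u≤r v≤r = u≤r ∷ alt-≤ n v≤r u≤r

alt-distinct : ∀ n {u v} → u ≢ v → AdjDistinct (alt u v n)
alt-distinct zero          u≢v = nil
alt-distinct (suc zero)    u≢v = one _
alt-distinct (suc (suc n)) u≢v = cons u≢v (alt-distinct (suc n) (≢-sym u≢v))

alt-snoc : ∀ n u v → alt u v n ++ [ altEnd u v n ] ≡ alt u v (suc n)
alt-snoc zero    u v = refl
alt-snoc (suc n) u v = cong (u ∷_) (alt-snoc n v u)

-- read backwards, an alternating list ends where it started
altEnd-altEnd : ∀ n u v → altEnd (altEnd u v n) (altEnd v u n) n ≡ u
altEnd-altEnd zero    u v = refl
altEnd-altEnd (suc n) u v = altEnd-altEnd n u v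

reverse-alt : ∀ n u v → reverse (alt u v (suc n)) ≡ alt (altEnd u v n) (altEnd v u n) (suc n)
reverse-alt zero    u v = refl
reverse-alt (suc n) u v = begin
    reverse (u ∷ alt v u (suc n))
  ≡⟨ reverse-++ [ u ] (alt v u (suc n)) ⟩
    reverse (alt v u (suc n)) ++ [ u ]
  ≡⟨ cong (_++ [ u ]) (reverse-alt n v u) ⟩
    alt a b (suc n) ++ [ u ]
  ≡⟨ cong (λ w → alt a b (suc n) ++ [ w ]) (sym (altEnd-altEnd n u v)) ⟩
    alt a b (suc n) ++ [ altEnd a b (suc n) ]
  ≡⟨ alt-snoc (suc n) a b ⟩
    alt a b (suc (suc n))
  ∎
  where
  open ≡-Reasoning
  a = altEnd v u n
  b = altEnd u v n

avoids-altEnd : ∀ n {u v m} → Avoids u v m → Avoids (altEnd u v n) (altEnd v u n) m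
avoids-altEnd zero    avoid = avoid
avoids-altEnd (suc n) avoid = avoids-altEnd n (avoids-sym avoid)

swapAlt-alt : ∀ n a b q → Avoids a b (head q) → swapAlt a b (alt a b n ++ q) ≡ alt b a n ++ q
swapAlt-alt zero a b [] avoid = refl
swapAlt-alt zero a b (z ∷ q) avoid with z ≟ a
... | yes z≡a = ⊥-elim (proj₁ (avoid refl) z≡a)
... | no _    = refl
swapAlt-alt (suc n) a b q avoid with a ≟ a
... | yes _   = cong (b ∷_) (swapAlt-alt n b a q (avoids-sym avoid))
... | no a≢a  = ⊥-elim (a≢a refl)

unreverse-alt : ∀ p n u v →
  reverse (alt (altEnd u v n) (altEnd v u n) (suc n) ++ reverse p) ≡ p ++ alt u v (suc n)
unreverse-alt p n u v = begin
    reverse (alt (altEnd u v n) (altEnd v u n) (suc n) ++ reverse p)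
  ≡⟨ cong (λ w → reverse (w ++ reverse p)) (sym (reverse-alt n u v)) ⟩
    reverse (reverse (alt u v (suc n)) ++ reverse p)
  ≡⟨ cong reverse (sym (reverse-++ p (alt u v (suc n)))) ⟩
    reverse (reverse (p ++ alt u v (suc n)))
  ≡⟨ reverse-involutive (p ++ alt u v (suc n)) ⟩
    p ++ alt u v (suc n)
  ∎
  where open ≡-Reasoning

involution-alt : ∀ p n u v → Avoids u v (last p) →
  Involution (p ++ alt u v (suc (suc n))) (p ++ alt v u (suc (suc n)))
involution-alt p n u v avoid =
  subst₂ Involution (unreverse-alt p (suc n) u v) swapped (involute a b (alt a b n ++ reverse p))
  where
  open ≡-Reasoning
  a = altEnd u v (suc n)
  b = altEnd v u (suc n)
  avoid-rev : Avoids a b (head (reverse p))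
  avoid-rev eq = avoids-altEnd (suc n) avoid (trans (sym (head-reverse p)) eq)
  swapped : reverse (swapAlt a b (alt a b (suc (suc n)) ++ reverse p)) ≡ p ++ alt v u (suc (suc n))
  swapped = begin
      reverse (swapAlt a b (alt a b (suc (suc n)) ++ reverse p))
    ≡⟨ cong reverse (swapAlt-alt (suc (suc n)) a b (reverse p) avoid-rev) ⟩
      reverse (alt b a (suc (suc n)) ++ reverse p)
    ≡⟨ unreverse-alt p (suc n) v u ⟩
      p ++ alt v u (suc (suc n))
    ∎

entry-≤ : ∀ {r k} p {x s} → HanoiState r k (p ++ x ∷ s) → x ≤ r
entry-≤ p h with ++⁻ʳ p (HanoiState.inRange h)
... | x≤r ∷ _ = x≤r

last-differs : ∀ p {x s} → AdjDistinct (p ++ x ∷ s) → ∀ {z} → last p ≡ just z → z ≢ x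
last-differs (w ∷ [])     (cons w≢x _) refl = w≢x
last-differs (w ∷ w' ∷ p) (cons _ d)   eq   = last-differs (w' ∷ p) d eq

distinct-retail : ∀ p {x s s'} → AdjDistinct (p ++ x ∷ s) → AdjDistinct (x ∷ s') →
                  AdjDistinct (p ++ x ∷ s')
distinct-retail []           d           d' = d'
distinct-retail (w ∷ [])     (cons ne _) d' = cons ne d'
distinct-retail (w ∷ w' ∷ p) (cons ne d) d' = cons ne (distinct-retail (w' ∷ p) d d')

hanoi-retail : ∀ {r k} p {x s s'} → length s' ≡ length s → All (_≤ r) s' → AdjDistinct (x ∷ s') →
               HanoiState r k (p ++ x ∷ s) → HanoiState r k (p ++ x ∷ s')
hanoi-retail {r} {k} p {x} {s} {s'} len≡ s'≤r d' h = record
  { len      = length-retail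
  ; inRange  = ++⁺ (++⁻ˡ p (inRange h)) (entry-≤ p h ∷ s'≤r)
  ; distinct = distinct-retail p (distinct h) d'
  }
  where
  open HanoiState
  open ≡-Reasoning
  length-retail : length (p ++ x ∷ s') ≡ k
  length-retail = begin
      length (p ++ x ∷ s')       ≡⟨ length-++ p ⟩
      length p + suc (length s') ≡⟨ cong (λ l → length p + suc l) len≡ ⟩
      length p + suc (length s)  ≡⟨ sym (length-++ p) ⟩
      length (p ++ x ∷ s)        ≡⟨ len h ⟩
      k                          ∎

_++ᴿ_ : ∀ {r Good n₁ n₂ a b c} → Reach r Good n₁ a b → Reach r Good n₂ b c → Reach r Good (n₁ + n₂) a c
done _       ++ᴿ R′ = R′
step g mv R ++ᴿ R′ = step g mv (R ++ᴿ R′)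

doubling : ∀ m {n₁ n₂} → n₁ < 2 ^ m → n₂ < 2 ^ m → n₁ + suc n₂ < 2 ^ suc m
doubling m n₁< n₂< = +-mono-≤ n₁< (≤-trans n₂< (≤-reflexive (sym (+-identityʳ (2 ^ m)))))

module Solver (r K : ℕ) (Good : List ℕ → Set)
              (good⇒hanoi : ∀ {xs} → Good xs → HanoiState r K xs)
              (good-retail : ∀ p {x s s'} → Good (p ++ x ∷ s) → HanoiState r K (p ++ x ∷ s') →
                             Good (p ++ x ∷ s'))
  where

  Solvable : ℕ → List ℕ → List ℕ → List ℕ → Set
  Solvable m p s t = ∃[ n ] (n < 2 ^ m × Reach r Good n (p ++ s) (p ++ t))

  freeze : ∀ p {x} s → Good (p ++ x ∷ s) → Good ((p ++ [ x ]) ++ s)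
  freeze p {x} s = subst Good (sym (++-assoc p [ x ] s))

  unfreeze : ∀ {n} p {x s t} → Reach r Good n ((p ++ [ x ]) ++ s) ((p ++ [ x ]) ++ t) →
             Reach r Good n (p ++ x ∷ s) (p ++ x ∷ t)
  unfreeze p {x} {s} {t} = subst₂ (Reach r Good _) (++-assoc p [ x ] s) (++-assoc p [ x ] t)

  solve : ∀ m p s t → length s ≡ m → length t ≡ m → Good (p ++ s) → Good (p ++ t) → Solvable m p s t
  switch : ∀ m p x y s t → x ≢ y → length s ≡ m → length t ≡ m →
           Good (p ++ x ∷ s) → Good (p ++ y ∷ t) → Solvable (suc m) p (x ∷ s) (y ∷ t)

  solve zero    p []      []      _  _  gs gt = 0 , s≤s z≤n , done gs
  solve (suc m) p (x ∷ s) (y ∷ t) ls lt gs gt with x ≟ y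
  ... | no x≢y = switch m p x y s t x≢y (suc-injective ls) (suc-injective lt) gs gt
  ... | yes refl =
    let n , n< , R = solve m (p ++ [ x ]) s t (suc-injective ls) (suc-injective lt)
                           (freeze p s gs) (freeze p t gt)
    in  n , <-≤-trans n< (m≤m+n (2 ^ m) _) , unfreeze p R

  switch zero p x y [] [] x≢y _ _ gs gt =
    1 , s≤s (s≤s z≤n) , step gs (inj₁ adjustment) (done gt)
    where
    ht = good⇒hanoi gt
    adjustment : Adjustment r (p ++ [ x ]) (p ++ [ y ])
    adjustment = adjust p x y (entry-≤ p ht) (≢-sym x≢y)
                        (λ _ eq → ≢-sym (last-differs p (HanoiState.distinct ht) eq))
  switch (suc j) p x y s t x≢y ls lt gs gt =
    let n₁ , n₁< , R₁ = solve (suc j) (p ++ [ x ]) s (alt y x (suc j)) ls (length-alt (suc j) y x)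
                              (freeze p s gs) (freeze p _ gA)
        n₂ , n₂< , R₂ = solve (suc j) (p ++ [ y ]) (alt x y (suc j)) t (length-alt (suc j) x y) lt
                              (freeze p _ gB) (freeze p t gt)
    in  n₁ + suc n₂ , doubling (suc j) n₁< n₂< ,
        unfreeze p R₁ ++ᴿ step gA (inj₂ (involution-alt p j x y avoid)) (unfreeze p R₂)
    where
    hs = good⇒hanoi gs
    ht = good⇒hanoi gt
    x≤r = entry-≤ p hs
    y≤r = entry-≤ p ht
    gA : Good (p ++ alt x y (suc (suc j)))
    gA = good-retail p gs (hanoi-retail p (trans (length-alt (suc j) y x) (sym ls))
                          (alt-≤ (suc j) y≤r x≤r) (alt-distinct (suc (suc j)) x≢y) hs)
    gB : Good (p ++ alt y x (suc (suc j)))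
    gB = good-retail p gt (hanoi-retail p (trans (length-alt (suc j) x y) (sym lt))
                          (alt-≤ (suc j) x≤r y≤r) (alt-distinct (suc (suc j)) (≢-sym x≢y)) ht)
    avoid : Avoids x y (last p)
    avoid eq = last-differs p (HanoiState.distinct hs) eq , last-differs p (HanoiState.distinct ht) eq

first-nonzero-retail : ∀ p {x s s'} → FirstNonzero (p ++ x ∷ s) → FirstNonzero (p ++ x ∷ s')
first-nonzero-retail []      (fnz x≢0) = fnz x≢0
first-nonzero-retail (_ ∷ _) (fnz w≢0) = fnz w≢0

within : ∀ k {P : ℕ → Set} → ∃[ n ] (n < 2 ^ k × P n) → ∃[ n ] (n ≤ 2 ^ k ∸ 1 × P n)
within k (n , n< , Pn) = n , ∸-monoˡ-≤ 1 n< , Pn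

lemma5 : (r k : ℕ) → 1 ≤ r → 1 ≤ k →
    ((a b : List ℕ) → HanoiState r k a → HanoiState r k b →
    ∃[ n ] (n ≤ 2 ^ k ∸ 1 × Reach r (HanoiState r k) n a b))
    × ((a b : List ℕ) → ProperHanoiState r k a → ProperHanoiState r k b →
    ∃[ n ] (n ≤ 2 ^ k ∸ 1 × Reach r (ProperHanoiState r k) n a b))
lemma5 r k _ _ = all-states , proper-states
  where
  open HanoiState
  module ForAll = Solver r k (HanoiState r k) id (λ _ _ h → h)
  module Proper = Solver r k (ProperHanoiState r k) proj₁
                         (λ p (_ , fa) h → h , first-nonzero-retail p fa)
  all-states : (a b : List ℕ) → HanoiState r k a → HanoiState r k b →
    ∃[ n ] (n ≤ 2 ^ k ∸ 1 × Reach r (HanoiState r k) n a b)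
  all-states a b ha hb = within k (ForAll.solve k [] a b (len ha) (len hb) ha hb)
  proper-states : (a b : List ℕ) → ProperHanoiState r k a → ProperHanoiState r k b →
    ∃[ n ] (n ≤ 2 ^ k ∸ 1 × Reach r (ProperHanoiState r k) n a b)
  proper-states a b pa pb = within k (Proper.solve k [] a b (len (proj₁ pa)) (len (proj₁ pb)) pa pb)
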